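{- Let $A\subseteq\mathbb{Z}^n$ and $\beta\in\mathbb{Z}^n$. Then $\beta$ has at most finitely many weak $A$-neighbors.
   Context: For $x\in\mathbb{R}^n$, $\pi_i(x)$ is its $i$-th coordinate. The rectangle from $x$ to $y$ is the set of $z\in\mathbb{R}^n$ such that for each $i$, $\pi_i(z)$ lies in the closed interval between $\pi_i(x)$ and $\pi_i(y)$. For $y\in\mathbb{R}^n$ and $A\subseteq\mathbb{R}^n$, an element $x\in A$ is a weak $A$-neighbor of $y$ if $x\ne y$ and no $z\in A$ other than $x$ and $y$ lies in the rectangle from $x$ to $y$. -}

module Defs where

open import Data.Nat using (ℕ)
open import Data.Integer using (ℤ; _≤_; _⊓_; _⊔_)
open import Data.Vec using (Vec; lookup)
open import Data.Fin using (Fin)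
open import Data.Product using (_×_)
open import Data.List using (List)
open import Data.List.Membership.Propositional using (_∈_)
open import Relation.Binary.PropositionalEquality using (_≡_)
open import Relation.Nullary using (¬_)
open import Data.Sum using (_⊎_)
open import Data.Product using (∃)
open import Data.Empty using (⊥)

π : ∀ {n} → Fin n → Vec ℤ n → ℤ
π i x = lookup x i

InRect : ∀ {n} → Vec ℤ n → Vec ℤ n → Vec ℤ n → Set
InRect x y z = ∀ i → (π i x ⊓ π i y ≤ π i z) × (π i z ≤ π i x ⊔ π i y)

WeakNeighbor : ∀ {n} → (Vec ℤ n → Set) → Vec ℤ n → Vec ℤ n → Set
WeakNeighbor A y x =
  A x × ¬ (x ≡ y) ×
  (∀ z → A z → InRect x y z → ¬ (z ≡ x) → ¬ (z ≡ y) → ⊥)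

-- A subset P is finite: all its elements occur in some list.
-- (Stated under double negation, the constructive reading of classical finiteness
--  for an arbitrary, non-decidable subset.)
FiniteSet : ∀ {n} → (Vec ℤ n → Set) → Set
FiniteSet {n} P = ¬ ¬ ∃ λ (L : List (Vec ℤ n)) → ∀ x → P x → x ∈ L

-- Two distinct weak neighbours x, y of β are incomparable: y is an A-point other than x and
-- β, so it lies outside the rectangle from x to β, i.e. some coordinate of y exceeds
-- max(xᵢ, βᵢ) or falls below min(xᵢ, βᵢ). Measuring how far each coordinate overshoots βᵢ
-- upwards and downwards therefore maps the weak neighbours injectively onto an antichain
-- of ℕ^(2n), and antichains of ℕ^k are finite by Dickson's lemma.
module Submission where

open import Defs
open import Data.Nat as ℕ using (ℕ; zero; suc)
import Data.Nat.Properties as ℕ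
open import Data.Integer as ℤ using (ℤ; 0ℤ; _≤_; _<_; _⊓_; _⊔_; _-_; -_; ∣_∣; +≤+; +<+)
open import Data.Integer.Properties
  using (_≤?_; ≰⇒>; <⇒≤; ≤-<-trans; <-≤-trans; i≤j⇒0≤j-i; i≥j⇒i⊔j≡i; i≤j⇒i⊓j≡i;
         i≤j⊔i; i⊓j≤j; +-monoˡ-<; +-monoʳ-<; neg-mono-<)
open import Data.Fin using (Fin; punchIn; punchOut; _↑ˡ_; _↑ʳ_; splitAt)
open import Data.Fin.Properties using (punchIn-punchOut; splitAt-↑ˡ; splitAt-↑ʳ; ¬∀⟶∃¬)
open import Data.Vec using (Vec)
open import Data.Vec.Properties using (≡-dec)
open import Data.List using (List; []; _∷_; _++_; allFin; upTo)
open import Data.List.Relation.Unary.Any using (here; there)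
open import Data.List.Membership.Propositional using (_∈_)
open import Data.List.Membership.Propositional.Properties using (∈-++⁺ˡ; ∈-++⁺ʳ; ∈-allFin; ∈-upTo⁺)
open import Data.Product using (_×_; _,_; ∃)
open import Data.Sum using (_⊎_; inj₁; inj₂; [_,_]′)
open import Data.Empty using (⊥-elim)
open import Function using (_∘_)
open import Level using (0ℓ)
open import Effect.Monad using (RawMonad)
open import Relation.Nullary using (¬_; yes; no)
open import Relation.Nullary.Decidable using (_×-dec_; ¬¬-excluded-middle)
open import Relation.Nullary.Negation using (¬¬-Monad)
open import Relation.Binary.Definitions using (DecidableEquality)
open import Relation.Binary.PropositionalEquality using (_≡_; _≢_; refl; sym; trans; subst)

open RawMonad (¬¬-Monad {0ℓ})

ListFinite : {X : Set} → (X → Set) → Set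
ListFinite {X} P = ∃ λ (L : List X) → ∀ x → P x → x ∈ L

module _ {X : Set} where

  ListFinite-⊆ : {P Q : X → Set} → (∀ x → P x → Q x) → ListFinite Q → ListFinite P
  ListFinite-⊆ P⊆Q (L , Q⊆L) = L , λ x px → Q⊆L x (P⊆Q x px)

  ListFinite-∪ : {P Q : X → Set} → ListFinite P → ListFinite Q → ListFinite (λ x → P x ⊎ Q x)
  ListFinite-∪ (L , P⊆L) (M , Q⊆M) = L ++ M , λ where
    x (inj₁ px) → ∈-++⁺ˡ (P⊆L x px)
    x (inj₂ qx) → ∈-++⁺ʳ L (Q⊆M x qx)

  ListFinite-singleton : (p : X) → ListFinite (_≡ p)
  ListFinite-singleton p = p ∷ [] , λ where x refl → here refl

  ¬¬ListFinite-⋃ : {C : Set} (Q : C → X → Set) (cs : List C) → (∀ c → ¬ ¬ ListFinite (Q c)) →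
                   ¬ ¬ ListFinite (λ x → ∃ λ c → c ∈ cs × Q c x)
  ¬¬ListFinite-⋃ Q [] _ = pure ([] , λ where _ (_ , () , _))
  ¬¬ListFinite-⋃ Q (c ∷ cs) fin = do
    Fc  ← fin c
    Fcs ← ¬¬ListFinite-⋃ Q cs fin
    pure (ListFinite-⊆ split (ListFinite-∪ Fc Fcs))
    where
    split : ∀ x → (∃ λ d → d ∈ c ∷ cs × Q d x) → Q c x ⊎ (∃ λ d → d ∈ cs × Q d x)
    split x (_ , here refl , q) = inj₁ q
    split x (d , there d∈cs , q) = inj₂ (d , d∈cs , q)

  ¬¬ListFinite-pointed : {P : X → Set} → (∀ {p} → P p → ¬ ¬ ListFinite P) → ¬ ¬ ListFinite P
  ¬¬ListFinite-pointed {P} fin = ¬¬-excluded-middle {A = ∃ P} >>= λ where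
    (yes (p , pp)) → fin pp
    (no ∄p)        → pure ([] , λ x px → ⊥-elim (∄p (x , px)))

  -- h maps P injectively onto an antichain of ℕ^k.
  Antichain : ∀ {k} → (Fin k → X → ℕ) → (X → Set) → Set
  Antichain h P = ∀ {x y} → P x → P y → x ≢ y → ∃ λ i → h i x ℕ.< h i y

  Slice : ∀ {k} → (Fin k → X → ℕ) → (X → Set) → Fin k → ℕ → X → Set
  Slice h P i c x = P x × h i x ≡ c

  Antichain-slice : ∀ {k} (h : Fin (suc k) → X → ℕ) {P} → Antichain h P →
                    ∀ i c → Antichain (h ∘ punchIn i) (Slice h P i c)
  Antichain-slice h anti i c (px , hx≡c) (py , hy≡c) x≢y with anti px py x≢y
  ... | j , hx<hy = punchOut i≢j , subst (λ t → h t _ ℕ.< h t _) (sym (punchIn-punchOut i≢j)) hx<hy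
    where
    i≢j : i ≢ j
    i≢j refl = ℕ.<-irrefl (trans hx≡c (sym hy≡c)) hx<hy

  module _ (_≟_ : DecidableEquality X) where

    Antichain-cover : ∀ {k} (h : Fin k → X → ℕ) {P} → Antichain h P → ∀ {p} → P p → ∀ x → P x →
                      x ≡ p ⊎ ∃ λ i → i ∈ allFin k × ∃ λ c → c ∈ upTo (h i p) × Slice h P i c x
    Antichain-cover h anti {p} pp x px with x ≟ p
    ... | yes x≡p = inj₁ x≡p
    ... | no x≢p with anti px pp x≢p
    ...   | i , hx<hp = inj₂ (i , ∈-allFin i , h i x , ∈-upTo⁺ hx<hp , px , refl)

    -- Fixing p ∈ P, every other point lies in one of the finitely many slices hᵢ = c < hᵢ p,
    -- and each slice is an antichain of ℕ^(k-1).
    Antichain⇒¬¬ListFinite : ∀ {k} (h : Fin k → X → ℕ) {P} → Antichain h P → ¬ ¬ ListFinite P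
    Slice-¬¬ListFinite : ∀ {k} (h : Fin k → X → ℕ) {P} → Antichain h P →
                         ∀ i c → ¬ ¬ ListFinite (Slice h P i c)

    Antichain⇒¬¬ListFinite {k} h anti = ¬¬ListFinite-pointed λ {p} pp → do
      slices ← ¬¬ListFinite-⋃ _ (allFin k) λ i →
                 ¬¬ListFinite-⋃ _ (upTo (h i p)) (Slice-¬¬ListFinite h anti i)
      pure (ListFinite-⊆ (Antichain-cover h anti pp) (ListFinite-∪ (ListFinite-singleton p) slices))

    Slice-¬¬ListFinite {suc k} h anti i c =
      Antichain⇒¬¬ListFinite (h ∘ punchIn i) (Antichain-slice h anti i c)

∣∣-mono-< : ∀ {i j} → 0ℤ ≤ i → i < j → ∣ i ∣ ℕ.< ∣ j ∣
∣∣-mono-< (+≤+ _) (+<+ m<n) = m<n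

⊔-overshoot-< : ∀ {a b c} → a ⊔ b < c → ∣ a ⊔ b - b ∣ ℕ.< ∣ c ⊔ b - b ∣
⊔-overshoot-< {a} {b} {c} a⊔b<c
  rewrite i≥j⇒i⊔j≡i (<⇒≤ (≤-<-trans (i≤j⊔i a b) a⊔b<c))
  = ∣∣-mono-< (i≤j⇒0≤j-i (i≤j⊔i a b)) (+-monoˡ-< (- b) a⊔b<c)

⊓-undershoot-< : ∀ {a b c} → c < a ⊓ b → ∣ b - a ⊓ b ∣ ℕ.< ∣ b - c ⊓ b ∣
⊓-undershoot-< {a} {b} {c} c<a⊓b
  rewrite i≤j⇒i⊓j≡i (<⇒≤ (<-≤-trans c<a⊓b (i⊓j≤j a b)))
  = ∣∣-mono-< (i≤j⇒0≤j-i (i⊓j≤j a b)) (+-monoʳ-< b (neg-mono-< c<a⊓b))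

module _ {n} (β : Vec ℤ n) where

  above below : Fin n → Vec ℤ n → ℕ
  above i x = ∣ π i x ⊔ π i β - π i β ∣
  below i x = ∣ π i β - π i x ⊓ π i β ∣

  overshoot : Fin (n ℕ.+ n) → Vec ℤ n → ℕ
  overshoot j = [ above , below ]′ (splitAt n j)

  WeakNeighbor-antichain : (A : Vec ℤ n → Set) → Antichain overshoot (WeakNeighbor A β)
  WeakNeighbor-antichain A {x} {y} (_ , _ , isolated) (ay , y≢β , _) x≢y
    with ¬∀⟶∃¬ n _ (λ i → (_ ≤? _) ×-dec (_ ≤? _)) (λ y∈rect → isolated y ay y∈rect (x≢y ∘ sym) y≢β)
  ... | i , y∉rectᵢ with π i x ⊓ π i β ≤? π i y
  ...   | no  y≱min = n ↑ʳ i , subst (λ s → [ above , below ]′ s x ℕ.< [ above , below ]′ s y) (sym (splitAt-↑ʳ n n i))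
                                 (⊓-undershoot-< (≰⇒> y≱min))
  ...   | yes y≥min = i ↑ˡ n , subst (λ s → [ above , below ]′ s x ℕ.< [ above , below ]′ s y) (sym (splitAt-↑ˡ n i n))
                                 (⊔-overshoot-< (≰⇒> (λ y≤max → y∉rectᵢ (y≥min , y≤max))))

mainTheorem5 : (n : ℕ) (A : Vec ℤ n → Set) (β : Vec ℤ n) → FiniteSet (WeakNeighbor A β)
mainTheorem5 n A β = Antichain⇒¬¬ListFinite (≡-dec ℤ._≟_) (overshoot β) (WeakNeighbor-antichain β A)
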